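{- Let $G$ be a connected graph. If every MNS ordering of $G$ is also a LexDFS ordering of $G$, then $G$ is $\{P_4, C_4\}$-free.
   Context: All graphs are finite and simple. For an ordering $\sigma$ of $V(G)$ write $x<_\sigma y$ if $x$ precedes $y$. In each of the following, the condition is required for all $a<_\sigma b<_\sigma c$ with $ac\in E(G)$ and $ab\notin E(G)$: $\sigma$ is a LexDFS ordering if there is $d$ with $a<_\sigma d<_\sigma b$, $db\in E(G)$, $dc\notin E(G)$; an MNS ordering if there is $d$ with $d<_\sigma b$, $db\in E(G)$, $dc\notin E(G)$. $\{P_4,C_4\}$-free means no induced path on 4 vertices and no induced 4-cycle. -}

module Defs where

open import Data.Nat using (ℕ)
open import Data.Fin using (Fin; _<_)
open import Data.Fin.Permutation using (Permutation′; _⟨$⟩ʳ_)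
open import Data.Product using (Σ; _×_)
open import Relation.Nullary using (¬_)
open import Relation.Binary.PropositionalEquality using (_≢_)

record Graph (n : ℕ) : Set₁ where
  field
    E     : Fin n → Fin n → Set
    irrefl : ∀ x → ¬ E x x
    sym   : ∀ x y → E x y → E y x
open Graph public

-- An ordering of V(G): a permutation σ, where σ ⟨$⟩ʳ x is the position of x.
Ordering : ℕ → Set
Ordering n = Permutation′ n

_⟨_⟩_ : ∀ {n} → Fin n → Ordering n → Fin n → Set
x ⟨ σ ⟩ y = (σ ⟨$⟩ʳ x) < (σ ⟨$⟩ʳ y)

IsLexDFS : ∀ {n} → Graph n → Ordering n → Set
IsLexDFS G σ = ∀ a b c → a ⟨ σ ⟩ b → b ⟨ σ ⟩ c → E G a c → ¬ E G a b →
  Σ _ λ d → a ⟨ σ ⟩ d × d ⟨ σ ⟩ b × E G d b × ¬ E G d c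

IsMNS : ∀ {n} → Graph n → Ordering n → Set
IsMNS G σ = ∀ a b c → a ⟨ σ ⟩ b → b ⟨ σ ⟩ c → E G a c → ¬ E G a b →
  Σ _ λ d → d ⟨ σ ⟩ b × E G d b × ¬ E G d c

data Walk {n} (G : Graph n) : Fin n → Fin n → Set where
  here : ∀ x → Walk G x x
  step : ∀ x y z → E G x y → Walk G y z → Walk G x z

Connected : ∀ {n} → Graph n → Set
Connected G = ∀ x y → Walk G x y

HasInducedP4 : ∀ {n} → Graph n → Set
HasInducedP4 G = Σ _ λ a → Σ _ λ b → Σ _ λ c → Σ _ λ d →
  a ≢ b × a ≢ c × a ≢ d × b ≢ c × b ≢ d × c ≢ d ×
  E G a b × E G b c × E G c d × ¬ E G a c × ¬ E G b d × ¬ E G a d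

HasInducedC4 : ∀ {n} → Graph n → Set
HasInducedC4 G = Σ _ λ a → Σ _ λ b → Σ _ λ c → Σ _ λ d →
  a ≢ b × a ≢ c × a ≢ d × b ≢ c × b ≢ d × c ≢ d ×
  E G a b × E G b c × E G c d × E G d a × ¬ E G a c × ¬ E G b d

P4C4Free : ∀ {n} → Graph n → Set
P4C4Free G = ¬ HasInducedP4 G × ¬ HasInducedC4 G

{-# OPTIONS --safe #-}
module Submission where

-- Let a–b–c–d be a path with a ≁ c and b ≁ d, i.e. an induced P₄ or C₄.  An MNS
-- ordering may start with a clique K ∋ b, then x := c, then the whole common
-- neighbourhood N of K ∪ {x}, and then a vertex y adjacent to all of K but not
-- to x (a is a candidate).  If some w ∈ N sees y but not z := d, the same
-- situation recurs with K ∪ {w} and y, and the common neighbourhood has shrunk.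
-- Otherwise complete the MNS search in any way: then x < y < z with xz ∈ E, xy ∉ E,
-- and every vertex between x and y lies in N, so none sees y without seeing z,
-- and the MNS ordering is not a LexDFS ordering.  Each phase is a legal MNS step
-- because it picks a vertex with the most visited neighbours within a class
-- from which all other unvisited vertices are separated by K or x.

open import Defs hiding (sym)
open import Axiom.UniquenessOfIdentityProofs using (module Decidable⇒UIP)
open import Data.Empty using (⊥; ⊥-elim)
import Data.Fin as Fin
open import Data.Fin using (Fin; toℕ; fromℕ<; _≟_)
open import Data.Fin.Permutation using (Permutation; permutation; _⟨$⟩ʳ_; _∘ₚ_; cast-id; ↔⇒≡)
open import Data.Fin.Properties using (toℕ-fromℕ<; toℕ-cast; toℕ<n; toℕ-injective)
open import Data.List using (List; []; _∷_; _++_; length; filter; allFin)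
open import Data.List.Extrema.Nat using (argmax; argmax-all; f[⊥]≤f[argmax]; f[xs]≤f[argmax])
open import Data.List.Membership.Propositional using (_∈_; _∉_; find; lose)
open import Data.List.Membership.Propositional.Properties using (∈-++⁺ʳ; ∈-++⁻; ∈-∃++; ∈-filter⁺; ∈-filter⁻; ∈-allFin)
open import Data.List.Membership.Setoid.Properties using (unique⇒irrelevant)
open import Data.List.Properties using (length-++; ++-assoc)
open import Data.List.Relation.Unary.All as All using (All; []; _∷_)
open import Data.List.Relation.Unary.All.Properties using (¬Any⇒All¬; ¬All⇒Any¬)
open import Data.List.Relation.Unary.AllPairs using (AllPairs; []; _∷_)
open import Data.List.Relation.Unary.Any using (here; there; any?)
open import Data.List.Relation.Unary.Unique.Propositional using (Unique)
open import Data.Nat using (ℕ; zero; suc; _≤_; _<_; z≤n; s≤s)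
import Data.Nat as ℕ
open import Data.Nat.Induction using (<-wellFounded)
open import Data.Nat.Properties using (≤-refl; <-irrefl; <-asym; <-cmp; <-≤-trans; <⇒≱; ≤∧≢⇒<; m≤n⇒m≤1+n; m<n⇒m<1+n; m≤n+m)
open import Data.Product using (Σ; ∃; _×_; _,_; proj₁; proj₂)
open import Data.Sum using (_⊎_; inj₁; inj₂)
open import Data.Unit using (tt)
open import Function using (Injection; _on_; case_of_)
open import Function.Properties.Inverse using (↔⇒↣)
open import Induction.WellFounded using (Acc; acc)
open import Relation.Binary using (Decidable; tri<; tri≈; tri>)
import Relation.Binary.Construct.On as On
open import Relation.Binary.PropositionalEquality using (_≡_; _≢_; refl; sym; trans; cong; subst; subst₂; setoid)
open import Relation.Nullary using (¬_; yes; no; ¬?; _×-dec_)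
open import Relation.Nullary.Decidable using (decidable-stable; ¬¬-excluded-middle)
import Relation.Unary as U

module _ {A : Set} where

  count : {P : A → Set} → U.Decidable P → List A → ℕ
  count P? [] = 0
  count P? (x ∷ xs) with P? x
  ... | yes _ = suc (count P? xs)
  ... | no _ = count P? xs

  module _ {P Q : A → Set} (P? : U.Decidable P) (Q? : U.Decidable Q) where

    count-mono : ∀ xs → (∀ {x} → x ∈ xs → P x → Q x) → count P? xs ≤ count Q? xs
    count-mono [] _ = z≤n
    count-mono (x ∷ xs) P⊆Q with P? x | Q? x
    ... | yes px | yes _ = s≤s (count-mono xs (λ y∈ → P⊆Q (there y∈)))
    ... | yes px | no ¬qx = ⊥-elim (¬qx (P⊆Q (here refl) px))
    ... | no _ | yes _ = m≤n⇒m≤1+n (count-mono xs (λ y∈ → P⊆Q (there y∈)))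
    ... | no _ | no _ = count-mono xs (λ y∈ → P⊆Q (there y∈))

    count-mono-< : ∀ xs → (∀ {x} → x ∈ xs → P x → Q x) →
                   ∀ {y} → y ∈ xs → Q y → ¬ P y → count P? xs < count Q? xs
    count-mono-< (x ∷ xs) P⊆Q (here refl) qy ¬py with P? x | Q? x
    ... | yes py | _ = ⊥-elim (¬py py)
    ... | no _ | yes _ = s≤s (count-mono xs (λ y∈ → P⊆Q (there y∈)))
    ... | no _ | no ¬qy = ⊥-elim (¬qy qy)
    count-mono-< (x ∷ xs) P⊆Q (there y∈) qy ¬py with P? x | Q? x
    ... | yes px | yes _ = s≤s (count-mono-< xs (λ z∈ → P⊆Q (there z∈)) y∈ qy ¬py)
    ... | yes px | no ¬qx = ⊥-elim (¬qx (P⊆Q (here refl) px))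
    ... | no _ | yes _ = m≤n⇒m≤1+n (count-mono-< xs (λ z∈ → P⊆Q (there z∈)) y∈ qy ¬py)
    ... | no _ | no _ = count-mono-< xs (λ z∈ → P⊆Q (there z∈)) y∈ qy ¬py

  argmax-on : {P : A → Set} → U.Decidable P → (f : A → ℕ) → ∀ xs →
              (∀ {x} → x ∈ xs → ¬ P x) ⊎
              ∃ λ m → m ∈ xs × P m × ∀ {x} → x ∈ xs → P x → f x ≤ f m
  argmax-on {P} P? f xs = over (filter P? xs) (∈-filter⁻ P?) (∈-filter⁺ P?)
    where
    over : ∀ ys → (∀ {x} → x ∈ ys → x ∈ xs × P x) → (∀ {x} → x ∈ xs → P x → x ∈ ys) →
           (∀ {x} → x ∈ xs → ¬ P x) ⊎
           ∃ λ m → m ∈ xs × P m × ∀ {x} → x ∈ xs → P x → f x ≤ f m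
    over [] _ complete = inj₁ λ x∈ px → case complete x∈ px of λ ()
    over (y ∷ ys) sound complete =
      inj₂ (m , proj₁ (sound m∈) , proj₂ (sound m∈) , λ x∈ px → bound (complete x∈ px))
      where
      m = argmax f y ys
      m∈ : m ∈ y ∷ ys
      m∈ = argmax-all f (here refl) (All.tabulate there)
      bound : ∀ {x} → x ∈ y ∷ ys → f x ≤ f m
      bound (here refl) = f[⊥]≤f[argmax] {f = f} y ys
      bound (there x∈) = All.lookup (f[xs]≤f[argmax] {f = f} y ys) x∈

-- Lists are stacks of visited vertices: the most recent visit comes first,
-- so pos p is the number of vertices visited before the one p points at.
module _ {A : Set} where

  pos : {L : List A} {v : A} → v ∈ L → ℕ
  pos {_ ∷ L} (here _) = length L
  pos (there p) = pos p

  pos<length : {L : List A} {v : A} (p : v ∈ L) → pos p < length L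
  pos<length (here _) = ≤-refl
  pos<length (there p) = m<n⇒m<1+n (pos<length p)

  pos-injective : {L : List A} {v w : A} (p : v ∈ L) (q : w ∈ L) → pos p ≡ pos q → v ≡ w
  pos-injective (here refl) (here refl) _ = refl
  pos-injective (here _) (there q) eq = ⊥-elim (<-irrefl (sym eq) (pos<length q))
  pos-injective (there p) (here _) eq = ⊥-elim (<-irrefl eq (pos<length p))
  pos-injective (there p) (there q) eq = pos-injective p q eq

  pos-surjective : (L : List A) {k : ℕ} → k < length L → ∃ λ v → Σ (v ∈ L) λ p → pos p ≡ k
  pos-surjective (v ∷ L) {k} (s≤s k≤) with k ℕ.≟ length L
  ... | yes refl = v , here refl , refl
  ... | no k≢ with pos-surjective L (≤∧≢⇒< k≤ k≢)
  ...   | w , p , eq = w , there p , eq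

  pos-++⁺ʳ : ∀ P {S : List A} {v : A} (p : v ∈ S) → pos (∈-++⁺ʳ P p) ≡ pos p
  pos-++⁺ʳ [] p = refl
  pos-++⁺ʳ (_ ∷ P) p = pos-++⁺ʳ P p

  pos<⇒∈suffix : ∀ P {b : A} {R : List A} {x : A} (p : x ∈ P ++ b ∷ R) →
                 pos p < length R → x ∈ R
  pos<⇒∈suffix [] (here _) lt = ⊥-elim (<-irrefl refl lt)
  pos<⇒∈suffix [] (there p) _ = p
  pos<⇒∈suffix (_ ∷ P) {b} {R} (here _) lt = ⊥-elim (<-asym lt R<P++b∷R)
    where
    R<P++b∷R : length R < length (P ++ b ∷ R)
    R<P++b∷R = subst (length R <_) (sym (length-++ P)) (m≤n+m (suc (length R)) (length P))
  pos<⇒∈suffix (_ ∷ P) (there p) lt = pos<⇒∈suffix P p lt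

precedes-total : ∀ {n} (σ : Ordering n) {x y} → x ≢ y → x ⟨ σ ⟩ y ⊎ y ⟨ σ ⟩ x
precedes-total σ {x} {y} x≢y with <-cmp (toℕ (σ ⟨$⟩ʳ x)) (toℕ (σ ⟨$⟩ʳ y))
... | tri< x<y _ _ = inj₁ x<y
... | tri> _ _ y<x = inj₂ y<x
... | tri≈ _ eq _ = ⊥-elim (x≢y (Injection.injective (↔⇒↣ σ) (toℕ-injective eq)))

module _ {n : ℕ} {L : List (Fin n)} (L-unique : Unique L) (complete : ∀ v → v ∈ L) where

  private
    pos-irrelevant : {v : Fin n} (p q : v ∈ L) → pos p ≡ pos q
    pos-irrelevant p q =
      cong pos (unique⇒irrelevant (setoid _) (Decidable⇒UIP.≡-irrelevant _≟_) L-unique p q)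

    position : Fin n → Fin (length L)
    position v = fromℕ< (pos<length (complete v))

    vertexAt : Fin (length L) → Fin n
    vertexAt i = proj₁ (pos-surjective L (toℕ<n i))

    position-vertexAt : ∀ i → position (vertexAt i) ≡ i
    position-vertexAt i with pos-surjective L (toℕ<n i)
    ... | w , p , eq = toℕ-injective (trans (toℕ-fromℕ< _) (trans (pos-irrelevant (complete w) p) eq))

    vertexAt-position : ∀ v → vertexAt (position v) ≡ v
    vertexAt-position v with pos-surjective L (toℕ<n (position v))
    ... | w , p , eq = pos-injective p (complete v) (trans eq (toℕ-fromℕ< _))

    positions : Permutation n (length L)
    positions = permutation position vertexAt position-vertexAt vertexAt-position

  ordering : Ordering n
  ordering = positions ∘ₚ cast-id (sym (↔⇒≡ positions))

  toℕ-ordering : {v : Fin n} (p : v ∈ L) → toℕ (ordering ⟨$⟩ʳ v) ≡ pos p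
  toℕ-ordering {v} p =
    trans (toℕ-cast _ (position v)) (trans (toℕ-fromℕ< _) (pos-irrelevant (complete v) p))

  private
    toℕ-split : ∀ {P b R} → L ≡ P ++ b ∷ R → toℕ (ordering ⟨$⟩ʳ b) ≡ length R
    toℕ-split {P} refl = trans (toℕ-ordering (∈-++⁺ʳ P (here refl))) (pos-++⁺ʳ P (here refl))

  precedes⇒∈suffix : ∀ {P b R} → L ≡ P ++ b ∷ R → ∀ {x} → x ⟨ ordering ⟩ b → x ∈ R
  precedes⇒∈suffix {P} refl {x} x<b =
    pos<⇒∈suffix P (complete x) (subst₂ _<_ (toℕ-ordering (complete x)) (toℕ-split refl) x<b)

  ∈suffix⇒precedes : ∀ {P b R} → L ≡ P ++ b ∷ R → ∀ {x} → x ∈ R → x ⟨ ordering ⟩ b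
  ∈suffix⇒precedes {P} refl x∈R = subst₂ _<_
    (sym (trans (toℕ-ordering (∈-++⁺ʳ P (there x∈R))) (pos-++⁺ʳ P (there x∈R))))
    (sym (toℕ-split refl)) (pos<length x∈R)

  ∉suffix⇒follows : ∀ {P b R} → L ≡ P ++ b ∷ R → ∀ {x} → x ∉ b ∷ R → b ⟨ ordering ⟩ x
  ∉suffix⇒follows eq x∉ with precedes-total ordering (λ x≡b → x∉ (here x≡b))
  ... | inj₁ x<b = ⊥-elim (x∉ (there (precedes⇒∈suffix eq x<b)))
  ... | inj₂ b<x = b<x

module Search {n : ℕ} (G : Graph n) (E? : Decidable (E G)) where

  open import Data.List.Membership.DecPropositional (_≟_ {n}) using (_∈?_)

  private
    V = Fin n

    _~_ : V → V → Set
    x ~ y = E G x y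

    ~-sym : ∀ {x y} → x ~ y → y ~ x
    ~-sym = Graph.sym G _ _

    ~-irrefl : ∀ {x} → ¬ x ~ x
    ~-irrefl = irrefl G _

  Separates : List V → V → V → Set
  Separates R v c = ∃ λ d → d ∈ R × d ~ v × ¬ d ~ c

  -- The MNS condition for v visited right after the vertices of R.
  Extends : List V → V → Set
  Extends R v = ∀ {a c} → a ∈ R → c ∉ R → c ≢ v → a ~ c → ¬ a ~ v → Separates R v c

  data MNSSearch : List V → Set where
    []    : MNSSearch []
    visit : ∀ {R v} → MNSSearch R → v ∉ R → Extends R v → MNSSearch (v ∷ R)

  search-unique : ∀ {L} → MNSSearch L → Unique L
  search-unique [] = []
  search-unique (visit s v∉L _) = ¬Any⇒All¬ _ v∉L ∷ search-unique s

  search-extends : ∀ P {b R} → MNSSearch (P ++ b ∷ R) → Extends R b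
  search-extends [] (visit _ _ ext) = ext
  search-extends (_ ∷ P) (visit s _ _) = search-extends P s

  complete-search⇒MNS : ∀ {L} (s : MNSSearch L) (complete : ∀ v → v ∈ L) →
                        IsMNS G (ordering (search-unique s) complete)
  complete-search⇒MNS s complete a b c a<b b<c a~c a≁b with ∈-∃++ (complete b)
  ... | P , R , eq with search-extends P (subst MNSSearch eq s) a∈R c∉R c≢b a~c a≁b
    where
    a∈R : a ∈ R
    a∈R = precedes⇒∈suffix (search-unique s) complete eq a<b
    c∉R : c ∉ R
    c∉R c∈R = <-asym b<c (∈suffix⇒precedes (search-unique s) complete eq c∈R)
    c≢b : c ≢ b
    c≢b refl = <-irrefl refl b<c
  ...   | d , d∈R , d~b , d≁c = d , ∈suffix⇒precedes (search-unique s) complete eq d∈R , d~b , d≁c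

  universal-extends : ∀ {R v} → All (v ~_) R → Extends R v
  universal-extends v~R a∈R _ _ _ a≁v = ⊥-elim (a≁v (~-sym (All.lookup v~R a∈R)))

  clique-search : ∀ {K} → AllPairs _~_ K → MNSSearch K
  clique-search [] = []
  clique-search (v~K ∷ K-clique) =
    visit (clique-search K-clique) (λ v∈K → ~-irrefl (All.lookup v~K v∈K)) (universal-extends v~K)

  weight : List V → V → ℕ
  weight R v = count (λ d → E? d v) R

  separated-or-covered : ∀ R v c → Separates R v c ⊎ (∀ {d} → d ∈ R → d ~ v → d ~ c)
  separated-or-covered R v c with any? (λ d → E? d v ×-dec ¬? (E? d c)) R
  ... | yes separator = inj₁ (find separator)
  ... | no ¬separator =
    inj₂ λ d∈R d~v → decidable-stable (E? _ c) λ d≁c → ¬separator (lose d∈R (d~v , d≁c))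

  -- If R could not separate v from c, every visited neighbour of v would be
  -- one of c, and c has the extra visited neighbour a.
  heavier-separates : ∀ {R a v c} → a ∈ R → a ~ c → ¬ a ~ v →
                      weight R c ≤ weight R v → Separates R v c
  heavier-separates {R} {_} {v} {c} a∈R a~c a≁v c≤v with separated-or-covered R v c
  ... | inj₁ separator = separator
  ... | inj₂ covered =
    ⊥-elim (<⇒≱ (count-mono-< (λ d → E? d v) (λ d → E? d c) R covered a∈R a~c a≁v) c≤v)

  data Choice (R : List V) (Q : V → Set) : Set where
    exhausted : (∀ {u} → u ∉ R → ¬ Q u) → Choice R Q
    heaviest  : ∀ v → v ∉ R → Q v →
                (∀ {u} → u ∉ R → Q u → weight R u ≤ weight R v) → Choice R Q

  choose : ∀ R {Q} → U.Decidable Q → Choice R Q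
  choose R Q? with argmax-on (λ u → ¬? (u ∈? R) ×-dec Q? u) (weight R) (allFin n)
  ... | inj₁ none = exhausted λ u∉R qu → none (∈-allFin _) (u∉R , qu)
  ... | inj₂ (v , _ , (v∉R , qv) , max) =
    heaviest v v∉R qv λ u∉R qu → max (∈-allFin _) (u∉R , qu)

  heaviest-extends : ∀ {R v} {Q : V → Set} → U.Decidable Q →
                     (∀ {u} → u ∉ R → Q u → weight R u ≤ weight R v) →
                     (∀ {c} → c ∉ R → ¬ Q c → Separates R v c) → Extends R v
  heaviest-extends Q? max outside {c = c} a∈R c∉R _ a~c a≁v with Q? c
  ... | yes qc = heavier-separates a∈R a~c a≁v (max c∉R qc)
  ... | no ¬qc = outside c∉R ¬qc

  unvisited : List V → ℕ
  unvisited R = count (λ u → ¬? (u ∈? R)) (allFin n)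

  unvisited-visit : ∀ {R v} → v ∉ R → unvisited (v ∷ R) < unvisited R
  unvisited-visit v∉R = count-mono-< _ _ (allFin n) (λ _ u∉v∷R u∈R → u∉v∷R (there u∈R))
    (∈-allFin _) v∉R (λ v∉v∷R → v∉v∷R (here refl))

  record Exhaustion (Q : V → Set) (R₀ : List V) : Set where
    field
      added     : List V
      search    : MNSSearch (added ++ R₀)
      added⊆Q   : ∀ {w} → w ∈ added → Q w
      saturated : ∀ {u} → u ∉ added ++ R₀ → ¬ Q u

  exhaust : ∀ {Q R₀} → U.Decidable Q → MNSSearch R₀ →
            (∀ {v c} → Q v → ¬ Q c → Separates R₀ v c) → Exhaustion Q R₀
  exhaust {Q} {R₀} Q? s₀ separates = go _ [] s₀ (λ ()) ≤-refl
    where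
    go : ∀ k W → MNSSearch (W ++ R₀) → (∀ {w} → w ∈ W → Q w) → unvisited (W ++ R₀) < k →
         Exhaustion Q R₀
    go (suc k) W s W⊆Q (s≤s bound) with choose (W ++ R₀) Q?
    ... | exhausted saturated = record { added = W ; search = s ; added⊆Q = W⊆Q ; saturated = saturated }
    ... | heaviest v v∉ qv max =
      go k (v ∷ W) (visit s v∉ (heaviest-extends Q? max outside))
        (λ { (here refl) → qv ; (there w∈W) → W⊆Q w∈W }) (<-≤-trans (unvisited-visit v∉) bound)
      where
      outside : ∀ {c} → c ∉ W ++ R₀ → ¬ Q c → Separates (W ++ R₀) v c
      outside _ ¬qc with separates qv ¬qc
      ... | d , d∈R₀ , d~v , d≁c = d , ∈-++⁺ʳ W d∈R₀ , d~v , d≁c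

  completion : ∀ {R} → MNSSearch R → ∃ λ P → MNSSearch (P ++ R) × ∀ v → v ∈ P ++ R
  completion s = added , search , λ v → decidable-stable (v ∈? _) λ v∉ → saturated v∉ tt
    where open Exhaustion (exhaust (λ _ → yes tt) s λ _ ¬tt → ⊥-elim (¬tt tt))

  lexDFS-violation : ∀ {L P W R x y z} (s : MNSSearch L) (complete : ∀ v → v ∈ L) →
                     L ≡ P ++ y ∷ W ++ x ∷ R → x ~ z → ¬ x ~ y → z ∉ y ∷ W ++ x ∷ R →
                     (∀ {w} → w ∈ W → w ~ y → w ~ z) →
                     ¬ IsLexDFS G (ordering (search-unique s) complete)
  lexDFS-violation {P = P} {W} {R} {x} {y} {z} s complete eq x~z x≁y z∉ W-covered lexDFS
    with lexDFS x y z x<y y<z x~z x≁y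
    where
    x<y = ∈suffix⇒precedes (search-unique s) complete eq (∈-++⁺ʳ W (here refl))
    y<z = ∉suffix⇒follows (search-unique s) complete eq z∉
  ... | d , x<d , d<y , d~y , d≁z with ∈-++⁻ W (precedes⇒∈suffix (search-unique s) complete eq d<y)
  ...   | inj₁ d∈W = d≁z (W-covered d∈W d~y)
  ...   | inj₂ (here refl) = x≁y d~y
  ...   | inj₂ (there d∈R) = <-asym x<d (∈suffix⇒precedes (search-unique s) complete eq′ d∈R)
    where
    eq′ = trans eq (sym (++-assoc P (y ∷ W) (x ∷ R)))

  Common : List V → V → V → Set
  Common K x u = u ~ x × All (u ~_) K

  Opposite : List V → V → V → Set
  Opposite K x u = All (u ~_) K × ¬ u ~ x

  clique-separates : ∀ {K v c} → All (v ~_) K → ¬ All (c ~_) K → Separates K v c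
  clique-separates {K} {c = c} v~K c≁K with find (¬All⇒Any¬ (E? c) K c≁K)
  ... | k , k∈K , c≁k = k , k∈K , ~-sym (All.lookup v~K k∈K) , λ k~c → c≁k (~-sym k~c)

  record Configuration : Set where
    field
      clique    : List V
      x y z     : V
      is-clique : AllPairs _~_ clique
      x~clique  : All (x ~_) clique
      y~clique  : All (y ~_) clique
      y≁x       : ¬ y ~ x
      y≢x       : y ≢ x
      z~x       : z ~ x
      z≁clique  : ¬ All (z ~_) clique
      z∉clique  : z ∉ clique

  common? : ∀ K x → U.Decidable (Common K x)
  common? K x u = E? u x ×-dec All.all? (E? u) K

  common-size : Configuration → ℕ
  common-size C = count (common? clique x) (allFin n)
    where open Configuration C

  module Round (C : Configuration) where
    open Configuration C

    x∉clique : x ∉ clique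
    x∉clique x∈K = ~-irrefl (All.lookup x~clique x∈K)

    clique-then-x : MNSSearch (x ∷ clique)
    clique-then-x = visit (clique-search is-clique) x∉clique (universal-extends x~clique)

    common-separates : ∀ {v c} → Common clique x v → ¬ Common clique x c →
                       Separates (x ∷ clique) v c
    common-separates {c = c} (v~x , v~K) ¬common with E? c x
    ... | no c≁x = x , here refl , ~-sym v~x , λ x~c → c≁x (~-sym x~c)
    ... | yes c~x with clique-separates v~K (λ c~K → ¬common (c~x , c~K))
    ...   | k , k∈K , k~v , k≁c = k , there k∈K , k~v , k≁c

    open Exhaustion (exhaust (common? clique x) clique-then-x common-separates) public
      renaming (added to W)

    opposite? : U.Decidable (Opposite clique x)
    opposite? u = All.all? (E? u) clique ×-dec ¬? (E? u x)

    y-unvisited : y ∉ W ++ x ∷ clique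
    y-unvisited y∈ with ∈-++⁻ W y∈
    ... | inj₁ y∈W = y≁x (proj₁ (added⊆Q y∈W))
    ... | inj₂ (here y≡x) = y≢x y≡x
    ... | inj₂ (there y∈K) = ~-irrefl (All.lookup y~clique y∈K)

    opposite-separates : ∀ {y′ c} → All (y′ ~_) clique → c ∉ W ++ x ∷ clique →
                         ¬ Opposite clique x c → Separates (W ++ x ∷ clique) y′ c
    opposite-separates {c = c} y′~K c∉ ¬opposite with All.all? (E? c) clique
    ... | yes c~K = ⊥-elim (case E? c x of λ where
          (yes c~x) → saturated c∉ (c~x , c~K)
          (no c≁x)  → ¬opposite (c~K , c≁x))
    ... | no c≁K with clique-separates y′~K c≁K
    ...   | k , k∈K , k~y′ , k≁c = k , ∈-++⁺ʳ W (there k∈K) , k~y′ , k≁c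

    visit-opposite : ∃ λ y′ → y′ ∉ W ++ x ∷ clique × Opposite clique x y′ ×
                              MNSSearch (y′ ∷ W ++ x ∷ clique)
    visit-opposite with choose (W ++ x ∷ clique) opposite?
    ... | exhausted none = ⊥-elim (none y-unvisited (y~clique , y≁x))
    ... | heaviest y′ y′∉ opposite max =
      y′ , y′∉ , opposite ,
      visit search y′∉ (heaviest-extends opposite? max (opposite-separates (proj₁ opposite)))

    z-unvisited : ∀ {y′} → ¬ y′ ~ x → z ∉ y′ ∷ W ++ x ∷ clique
    z-unvisited y′≁x (here refl) = y′≁x z~x
    z-unvisited y′≁x (there z∈) with ∈-++⁻ W z∈
    ... | inj₁ z∈W = z≁clique (proj₂ (added⊆Q z∈W))
    ... | inj₂ (here refl) = ~-irrefl z~x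
    ... | inj₂ (there z∈K) = z∉clique z∈K

    enlarge : ∀ {y′} → Opposite clique x y′ → y′ ∉ W ++ x ∷ clique → Separates W y′ z →
              ∃ λ C′ → common-size C′ < common-size C
    enlarge {y′} (y′~K , y′≁x) y′∉ (w , w∈W , w~y′ , w≁z) = C′ , C′<C
      where
      w~x = proj₁ (added⊆Q w∈W)
      w~K = proj₂ (added⊆Q w∈W)

      C′ : Configuration
      C′ = record
        { clique = w ∷ clique ; x = x ; y = y′ ; z = z
        ; is-clique = w~K ∷ is-clique
        ; x~clique = ~-sym w~x ∷ x~clique
        ; y~clique = ~-sym w~y′ ∷ y′~K
        ; y≁x = y′≁x
        ; y≢x = λ { refl → y′∉ (∈-++⁺ʳ W (here refl)) }
        ; z~x = z~x
        ; z≁clique = λ { (_ ∷ z~K) → z≁clique z~K }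
        ; z∉clique = λ { (here refl) → z≁clique w~K ; (there z∈K) → z∉clique z∈K }
        }

      C′<C : common-size C′ < common-size C
      C′<C = count-mono-< (common? (w ∷ clique) x) (common? clique x) (allFin n)
        (λ { _ (u~x , _ ∷ u~K) → u~x , u~K }) (∈-allFin w) (added⊆Q w∈W)
        λ { (_ , w~w ∷ _) → ~-irrefl w~w }

    violation : ∀ {y′} → Opposite clique x y′ → MNSSearch (y′ ∷ W ++ x ∷ clique) →
                (∀ {w} → w ∈ W → w ~ y′ → w ~ z) → ∃ λ σ → IsMNS G σ × ¬ IsLexDFS G σ
    violation (_ , y′≁x) s covered with completion s
    ... | P , s′ , complete =
      ordering (search-unique s′) complete , complete-search⇒MNS s′ complete ,
      lexDFS-violation s′ complete refl (~-sym z~x) (λ x~y′ → y′≁x (~-sym x~y′))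
        (z-unvisited y′≁x) covered

    shrinks-or-violates : (∃ λ C′ → common-size C′ < common-size C) ⊎
                          (∃ λ σ → IsMNS G σ × ¬ IsLexDFS G σ)
    shrinks-or-violates with visit-opposite
    ... | y′ , y′∉ , opposite , s with separated-or-covered W y′ z
    ...   | inj₁ separator = inj₁ (enlarge opposite y′∉ separator)
    ...   | inj₂ covered = inj₂ (violation opposite s covered)

  module _ (mns⇒lexDFS : ∀ σ → IsMNS G σ → IsLexDFS G σ) where

    no-configuration : Configuration → ⊥
    no-configuration C = go (On.wellFounded common-size <-wellFounded C)
      where
      go : ∀ {C} → Acc (_<_ on common-size) C → ⊥
      go {C} (acc smaller) with Round.shrinks-or-violates C
      ... | inj₁ (C′ , C′<C) = go (smaller {C′} C′<C)
      ... | inj₂ (σ , mns , ¬lexDFS) = ¬lexDFS (mns⇒lexDFS σ mns)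

    no-P₄-or-C₄ : ∀ {a b c d} → a ≢ c → b ≢ d → a ~ b → b ~ c → c ~ d → ¬ a ~ c → ¬ b ~ d → ⊥
    no-P₄-or-C₄ {a} {b} {c} {d} a≢c b≢d a~b b~c c~d a≁c b≁d = no-configuration record
      { clique = b ∷ [] ; x = c ; y = a ; z = d
      ; is-clique = [] ∷ []
      ; x~clique = ~-sym b~c ∷ []
      ; y~clique = a~b ∷ []
      ; y≁x = a≁c
      ; y≢x = a≢c
      ; z~x = ~-sym c~d
      ; z≁clique = λ { (d~b ∷ []) → b≁d (~-sym d~b) }
      ; z∉clique = λ { (here refl) → b≢d refl }
      }

¬¬-Π-Fin : ∀ {m} {P : Fin m → Set} → (∀ i → ¬ ¬ P i) → ¬ ¬ (∀ i → P i)
¬¬-Π-Fin {zero} _ k = k λ ()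
¬¬-Π-Fin {suc m} h k = h Fin.zero λ p₀ → ¬¬-Π-Fin (λ i → h (Fin.suc i)) λ rest → k λ where
  Fin.zero    → p₀
  (Fin.suc i) → rest i

lemma10 : ∀ (n : ℕ) (G : Graph n) → Connected G →
    (∀ (σ : Ordering n) → IsMNS G σ → IsLexDFS G σ) →
    P4C4Free G
lemma10 n G _ mns⇒lexDFS = no-P₄ , no-C₄
  where
  -- Adjacency is decidable only classically; the goal is negative, so that suffices.
  decidable-adjacency : ¬ ¬ Decidable (E G)
  decidable-adjacency = ¬¬-Π-Fin λ x → ¬¬-Π-Fin λ y → ¬¬-excluded-middle

  no-P₄ : ¬ HasInducedP4 G
  no-P₄ (a , b , c , d , _ , a≢c , _ , _ , b≢d , _ , ab , bc , cd , ¬ac , ¬bd , _) =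
    decidable-adjacency λ E? → Search.no-P₄-or-C₄ G E? mns⇒lexDFS a≢c b≢d ab bc cd ¬ac ¬bd

  no-C₄ : ¬ HasInducedC4 G
  no-C₄ (a , b , c , d , _ , a≢c , _ , _ , b≢d , _ , ab , bc , cd , _ , ¬ac , ¬bd) =
    decidable-adjacency λ E? → Search.no-P₄-or-C₄ G E? mns⇒lexDFS a≢c b≢d ab bc cd ¬ac ¬bd
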